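{- Let $\mu$ be a partition with $\mu_1=\ell$ and conjugate $\mu'=(c_\ell,\ldots,c_1)$, let $\lambda\supseteq\mu$ be a partition and let $\mathbf{T}=(T_1,\ldots,T_\ell)$ be a vector of nonnegative integers. There is a bijection from the set of maximal multiset tableaux $P\in\overline{MT}(\mu)$ with $wt(P)=\lambda$ and $cw(P)=\mathbf{T}$ to the set of restricted tableaux $R\in RT(\lambda/\mu)$ with $wt(R)=\mathbf{T}$.
   Context: A multiset tableau of shape $\mu$ (element of $MT(\mu)$) is a left-justified arrangement of boxes with $\mu_i$ boxes in row $i$ (rows numbered from the top), each box filled with a nonempty multiset of positive integers, such that the maximum of each box is strictly less than the minimum of the box directly below it (if it exists) and weakly less than the minimum of the box directly to its right (if it exists). The columns are labelled from left to right by $\ell,\ell-1,\ldots,1$; so column $j$ has $c_j$ boxes. $b_{ij}$ denotes the box in row $i$ and column labelled $j$, $|b_{ij}|$ the number of entries (with multiplicity) in it, with the convention $|b_{ij}|=0$ if no such box exists (in particular $|b_{i0}|=0$). The weight $wt(P)=(w_1,w_2,\ldots)$ where $w_i$ is the total number of entries equal to $i$; the column weight $cw(P)=(T_1,\ldots,T_\ell)$ where $T_j$ is the number of entries in column $j$ minus $c_j$. A maximal multiset tableau (element of $\overline{MT}(\mu)$) is $P\in MT(\mu)$ such that (1) each box $b_{ij}$ contains only entries equal to $i$, and (2) for each $i\ge1$ and $k\ge0$, $\sum_{1\le j\le k}\big(|b_{(i+1)j}|-|b_{i(j-1)}|\big)\le 1$. A restricted tableau $R\in RT(\lambda/\mu)$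 is a semistandard Young tableau of skew shape $\lambda/\mu$ with entries in $\{1,\ldots,\ell\}$ such that every entry $i$ lies in a row with index at most $c_i$; $wt(R)=(w_1,\ldots,w_\ell)$ with $w_i$ the number of entries equal to $i$. -}

module Defs where

open import Data.Nat using (ℕ; zero; suc; _+_; _∸_; _≤_; _<_; _≟_; _≤?_)
open import Data.List using (List; []; _∷_; length; map; filter)
open import Data.Nat.ListAction using (sum)
open import Data.List.Relation.Unary.All using (All)
open import Data.List.Relation.Unary.Linked using (Linked)
open import Data.List.Membership.Propositional using (_∈_)
open import Data.Maybe using (Maybe; just; nothing)
open import Data.Product using (Σ; _×_)
open import Relation.Binary.PropositionalEquality using (_≡_; _≢_)

-- nth xs i : the i-th element (1-based); nothing for i = 0 or i > length
nth : {A : Set} → List A → ℕ → Maybe A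
nth xs zero = nothing
nth [] (suc i) = nothing
nth (x ∷ xs) (suc zero) = just x
nth (x ∷ xs) (suc (suc i)) = nth xs (suc i)

nthL : {A : Set} → List (List A) → ℕ → List A
nthL xs i with nth xs i
... | just r = r
... | nothing = []

-- i-th part of a partition (1-based), 0 if it does not exist (or i = 0)
part : List ℕ → ℕ → ℕ
part xs i with nth xs i
... | just m = m
... | nothing = 0

count : ℕ → List ℕ → ℕ
count n xs = length (filter (n ≟_) xs)

sumTo : ℕ → (ℕ → ℕ) → ℕ
sumTo zero f = 0
sumTo (suc k) f = sumTo k f + f (suc k)

IsPartition : List ℕ → Set
IsPartition μ = Linked (λ a b → b ≤ a) μ × All (λ m → 1 ≤ m) μ

_⊆ₚ_ : List ℕ → List ℕ → Set
μ ⊆ₚ λ' = ∀ i → part μ i ≤ part λ' i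

-- c_j for μ with μ₁ = ℓ : the number of boxes in the column labelled j,
-- i.e. in the (ℓ+1-j)-th column from the left: #{ i : μ_i ≥ ℓ+1-j }
colLen : ℕ → List ℕ → ℕ → ℕ
colLen ℓ μ j = length (filter (λ m → suc ℓ ∸ j ≤? m) μ)

-- A box (a nonempty finite multiset of positive integers) is represented
-- canonically as a weakly increasing nonempty list of positive integers.
-- A tableau is the list of its rows (top to bottom), each row the list of
-- its boxes from left to right.

Tab : Set
Tab = List (List (List ℕ))

BoxAt : Tab → ℕ → ℕ → List ℕ
BoxAt P i p = nthL (nthL P i) p

-- |b_{ij}| where j is the column LABEL (columns labelled ℓ,…,1 from left),
-- so column j is position ℓ+1-j; 0 if the box does not exist, |b_{i0}| = 0
bsize : ℕ → Tab → ℕ → ℕ → ℕ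
bsize ℓ P i zero = 0
bsize ℓ P i (suc j) = length (BoxAt P i (ℓ ∸ j))

IsMT : List ℕ → Tab → Set
IsMT μ P =
    map length P ≡ μ
  × All (All (λ b → (b ≢ []) × Linked _≤_ b × All (λ x → 1 ≤ x) b)) P
  × (∀ i p x y → x ∈ BoxAt P i p → y ∈ BoxAt P (suc i) p → x < y)
  × (∀ i p x y → x ∈ BoxAt P i p → y ∈ BoxAt P i (suc p) → x ≤ y)

wtMT : Tab → ℕ → ℕ
wtMT P n = sum (map (λ row → sum (map (count n) row)) P)

colEntries : ℕ → Tab → ℕ → ℕ
colEntries ℓ P j = sum (map (λ row → length (nthL row (suc ℓ ∸ j))) P)

IsMaxMT : ℕ → List ℕ → Tab → Set
IsMaxMT ℓ μ P =
    IsMT μ P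
  × (∀ i p x → x ∈ BoxAt P i p → x ≡ i)
  -- for i ≥ 1, k ≥ 0 : Σ_{1≤j≤k} (|b_{(i+1)j}| - |b_{i(j-1)}|) ≤ 1,
  -- written with both sums moved to ℕ
  × (∀ i k → sumTo k (λ j → bsize ℓ P (suc (suc i)) j)
               ≤ 1 + sumTo k (λ j → bsize ℓ P (suc i) (j ∸ 1)))

-- Restricted tableaux of skew shape λ/μ.
-- Represented as the list of rows (top to bottom); row i lists the entries
-- of row i of λ/μ from left to right (columns μ_i+1, …, λ_i).

SkewTab : Set
SkewTab = List (List ℕ)

-- entry of R in row i and (ordinary, left-to-right) column x
ent : List ℕ → SkewTab → ℕ → ℕ → Maybe ℕ
ent μ R i x = nth (nthL R i) (x ∸ part μ i)

IsRT : ℕ → List ℕ → List ℕ → SkewTab → Set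
IsRT ℓ λ' μ R =
    length R ≡ length λ'
  × (∀ i → length (nthL R i) ≡ part λ' i ∸ part μ i)
  × (∀ i x a b → ent μ R i x ≡ just a → ent μ R i (suc x) ≡ just b → a ≤ b)
  × (∀ i x a b → ent μ R i x ≡ just a → ent μ R (suc i) x ≡ just b → a < b)
  × (∀ i x a → ent μ R i x ≡ just a → 1 ≤ a × a ≤ ℓ × i ≤ colLen ℓ μ a)

wtRT : SkewTab → ℕ → ℕ
wtRT R n = sum (map (count n) R)

Bijection : {X Y : Set} → (X → Set) → (Y → Set) → Set
Bijection {X} {Y} A B =
  Σ (X → Y) λ f →
      (∀ x → A x → B (f x))
    × (∀ x x' → A x → A x' → f x ≡ f x' → x ≡ x')
    × (∀ y → B y → Σ X λ x → A x × f x ≡ y)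

-- A maximal multiset tableau has row i filled with i's, so it is determined by its box sizes.
-- Row i is sent to the sorted row of R in which each column label j occurs |b_ij| - 1 times; it has
-- λ_i - μ_i entries, and a label j in row i satisfies i ≤ c_j because b_ij exists. Summing box sizes
-- over the columns 1..k of a row gives (number of boxes there) + (number of labels ≤ k), which turns
-- the maximality inequality between rows i and i+1 into
--   μ_{i+1} + #{labels ≤ k+1 in row i+1} ≤ μ_i + #{labels ≤ k in row i}   for all k,
-- and this is exactly column-strictness of R between those rows. The inverse rebuilds each box
-- of row i as 1 + (number of labels j) copies of i.

module Submission where

open import Defs
open import Data.Nat using (ℕ; suc; _+_)
open import Data.Fin using (toℕ)
open import Data.Vec using (Vec; lookup)
open import Data.List using (List)
open import Data.Product using (_×_)
open import Relation.Binary.PropositionalEquality using (_≡_)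

open import Data.Nat
open import Data.Nat.Properties
open import Data.Nat.ListAction using (sum)
open import Data.Nat.Tactic.RingSolver using (solve-∀)
open import Data.Fin.Properties using (toℕ<n)
open import Data.List using (List; []; _∷_; length; map; filter; replicate; drop; _++_)
open import Data.List.Properties
  using ( length-map; length-filter; length-++; length-replicate
        ; filter-accept; filter-reject; filter-none; filter-all; filter-++)
open import Data.List.Membership.Propositional using (_∈_)
open import Data.List.Relation.Unary.Any using (here; there)
open import Data.List.Relation.Unary.All as All using (All; []; _∷_)
open import Data.List.Relation.Unary.All.Properties using (++⁺; replicate⁺; all-filter; filter⁺)
open import Data.List.Relation.Unary.AllPairs using (AllPairs; []; _∷_)
import Data.List.Relation.Unary.AllPairs.Properties as AllPairs
open import Data.List.Relation.Unary.Linked using (Linked; []; [-]; _∷_)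
open import Data.List.Relation.Unary.Linked.Properties using (Linked⇒AllPairs; AllPairs⇒Linked)
open import Data.Maybe using (just; nothing)
open import Data.Product using (Σ; _,_; proj₁; proj₂)
open import Data.Unit using (⊤; tt)
open import Data.Empty using (⊥-elim)
open import Function.Bundles using (_⇔_; mk⇔; Equivalence)
open import Relation.Nullary using (yes; no; ¬_)
open import Relation.Binary.PropositionalEquality

nthL-[] : {A : Set} (i : ℕ) → nthL {A} [] i ≡ []
nthL-[] zero = refl
nthL-[] (suc i) = refl

nthL-∷-suc : {A : Set} (x : List A) (xs : List (List A)) (i : ℕ) →
             nthL (x ∷ xs) (suc (suc i)) ≡ nthL xs (suc i)
nthL-∷-suc x xs i with nth xs (suc i)
... | just r = refl
... | nothing = refl

part-[] : (i : ℕ) → part [] i ≡ 0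
part-[] zero = refl
part-[] (suc i) = refl

part-∷-suc : (x : ℕ) (xs : List ℕ) (i : ℕ) → part (x ∷ xs) (suc (suc i)) ≡ part xs (suc i)
part-∷-suc x xs i with nth xs (suc i)
... | just r = refl
... | nothing = refl

nth-[] : {A : Set} (y : ℕ) → nth {A} [] y ≡ nothing
nth-[] zero = refl
nth-[] (suc y) = refl

nth≡just⇒∈ : {A : Set} {u : List A} {y : ℕ} {a : A} → nth u y ≡ just a → a ∈ u
nth≡just⇒∈ {u = x ∷ u} {suc zero} refl = here refl
nth≡just⇒∈ {u = x ∷ u} {suc (suc y)} e = there (nth≡just⇒∈ {u = u} {suc y} e)

∈⇒nth≡just : {A : Set} {u : List A} {a : A} → a ∈ u → Σ ℕ λ y → nth u (suc y) ≡ just a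
∈⇒nth≡just (here refl) = 0 , refl
∈⇒nth≡just (there m) with ∈⇒nth≡just m
... | y , e = suc y , e

nth≡just⇒inRange : {A : Set} {u : List A} {y : ℕ} {a : A} → nth u y ≡ just a → 1 ≤ y × y ≤ length u
nth≡just⇒inRange {u = x ∷ u} {suc zero} refl = s≤s z≤n , s≤s z≤n
nth≡just⇒inRange {u = x ∷ u} {suc (suc y)} e with nth≡just⇒inRange {u = u} {suc y} e
... | _ , q = s≤s z≤n , s≤s q

nth-inRange : {A : Set} (u : List A) (y : ℕ) → 1 ≤ y → y ≤ length u → Σ A λ a → nth u y ≡ just a
nth-inRange (x ∷ u) (suc zero) _ _ = x , refl
nth-inRange (x ∷ u) (suc (suc y)) _ (s≤s q) = nth-inRange u (suc y) (s≤s z≤n) q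

∈⇒nthL≡ : {A : Set} {b : List A} {xs : List (List A)} → b ∈ xs → Σ ℕ λ p → nthL xs (suc p) ≡ b
∈⇒nthL≡ (here refl) = 0 , refl
∈⇒nthL≡ {xs = x ∷ xs} (there m) with ∈⇒nthL≡ m
... | p , e = suc p , trans (nthL-∷-suc x xs p) e

All-nthL : {A : Set} {Q : List A → Set} {xs : List (List A)} → All Q xs → Q [] → ∀ p → Q (nthL xs p)
All-nthL _ q[] zero = q[]
All-nthL [] q[] (suc p) = q[]
All-nthL (qx ∷ _) q[] (suc zero) = qx
All-nthL {xs = x ∷ xs} (_ ∷ qs) q[] (suc (suc p)) rewrite nthL-∷-suc x xs p = All-nthL qs q[] (suc p)

nthL-map : {A B : Set} (f : List A → List B) → f [] ≡ [] →
           (xs : List (List A)) (i : ℕ) → nthL (map f xs) i ≡ f (nthL xs i)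
nthL-map f f[] xs zero = sym f[]
nthL-map f f[] [] (suc i) = sym f[]
nthL-map f f[] (x ∷ xs) (suc zero) = refl
nthL-map f f[] (x ∷ xs) (suc (suc i))
  rewrite nthL-∷-suc (f x) (map f xs) i | nthL-∷-suc x xs i = nthL-map f f[] xs (suc i)

length-nthL : {A : Set} (xs : List (List A)) (i : ℕ) → length (nthL xs i) ≡ part (map length xs) i
length-nthL xs zero = refl
length-nthL [] (suc i) = refl
length-nthL (x ∷ xs) (suc zero) = refl
length-nthL (x ∷ xs) (suc (suc i))
  rewrite nthL-∷-suc x xs i | part-∷-suc (length x) (map length xs) i = length-nthL xs (suc i)

nthL-beyond : {A : Set} (xs : List (List A)) (i : ℕ) → length xs < i → nthL xs i ≡ []
nthL-beyond [] i _ = nthL-[] i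
nthL-beyond (x ∷ xs) (suc (suc i)) (s≤s q) rewrite nthL-∷-suc x xs i = nthL-beyond xs (suc i) q

nthL-ext : {A : Set} (xs ys : List (List A)) → length xs ≡ length ys →
           (∀ t → nthL xs (suc t) ≡ nthL ys (suc t)) → xs ≡ ys
nthL-ext [] [] _ _ = refl
nthL-ext (x ∷ xs) (y ∷ ys) l e = cong₂ _∷_ (e 0) (nthL-ext xs ys (suc-injective l) λ t →
  trans (sym (nthL-∷-suc x xs t)) (trans (e (suc t)) (nthL-∷-suc y ys t)))

part-beyond : (xs : List ℕ) (i : ℕ) → length xs < i → part xs i ≡ 0
part-beyond [] i _ = part-[] i
part-beyond (x ∷ xs) (suc (suc i)) (s≤s q) rewrite part-∷-suc x xs i = part-beyond xs (suc i) q

part-pos⇒≤length : (xs : List ℕ) (i : ℕ) → 1 ≤ part xs i → i ≤ length xs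
part-pos⇒≤length xs i p with length xs <? i
... | yes q = ⊥-elim (<⇒≱ (s≤s z≤n) (subst (1 ≤_) (part-beyond xs i q) p))
... | no q = ≮⇒≥ q

part-pos : (xs : List ℕ) → All (1 ≤_) xs → (i : ℕ) → 1 ≤ i → i ≤ length xs → 1 ≤ part xs i
part-pos (x ∷ xs) (p ∷ _) (suc zero) _ _ = p
part-pos (x ∷ xs) (_ ∷ ps) (suc (suc i)) _ (s≤s q) rewrite part-∷-suc x xs i = part-pos xs ps (suc i) (s≤s z≤n) q

part≤head : {x : ℕ} {xs : List ℕ} → All (_≤ x) xs → ∀ i → part xs i ≤ x
part≤head _ zero = z≤n
part≤head [] (suc i) = z≤n
part≤head (p ∷ _) (suc zero) = p
part≤head {xs = y ∷ ys} (_ ∷ ps) (suc (suc i)) rewrite part-∷-suc y ys i = part≤head ps (suc i)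

tail≤head : {x : ℕ} {xs : List ℕ} → Linked _≥_ (x ∷ xs) → All (_≤ x) xs
tail≤head l with Linked⇒AllPairs (λ p q → ≤-trans q p) l
... | p ∷ _ = p

Linked-tail : {R : ℕ → ℕ → Set} {x : ℕ} {xs : List ℕ} → Linked R (x ∷ xs) → Linked R xs
Linked-tail [-] = []
Linked-tail (_ ∷ l) = l

part-antitone : {xs : List ℕ} → Linked _≥_ xs → ∀ t → part xs (suc (suc t)) ≤ part xs (suc t)
part-antitone {[]} _ t = z≤n
part-antitone {x ∷ xs} l zero = part≤head (tail≤head l) 1
part-antitone {x ∷ xs} l (suc t)
  rewrite part-∷-suc x xs t | part-∷-suc x xs (suc t) = part-antitone (Linked-tail l) t

part≤part1 : {xs : List ℕ} → Linked _≥_ xs → ∀ i → part xs i ≤ part xs 1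
part≤part1 l zero = z≤n
part≤part1 l (suc zero) = ≤-refl
part≤part1 l (suc (suc t)) = ≤-trans (part-antitone l t) (part≤part1 l (suc t))

count≥ : ℕ → List ℕ → ℕ
count≥ q xs = length (filter (q ≤?_) xs)

≤part⇒<count≥ : {μ : List ℕ} → Linked _≥_ μ → ∀ q t → 1 ≤ q → q ≤ part μ (suc t) →
                suc t ≤ count≥ q μ
≤part⇒<count≥ {[]} _ q t q≥1 p = ⊥-elim (<⇒≱ q≥1 p)
≤part⇒<count≥ {x ∷ μ} l q zero _ p rewrite filter-accept (q ≤?_) {x} {μ} p = s≤s z≤n
≤part⇒<count≥ {x ∷ μ} l q (suc t) q≥1 p rewrite part-∷-suc x μ t
  rewrite filter-accept (q ≤?_) {x} {μ} (≤-trans p (part≤head (tail≤head l) (suc t)))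
  = s≤s (≤part⇒<count≥ (Linked-tail l) q t q≥1 p)

<count≥⇒≤part : {μ : List ℕ} → Linked _≥_ μ → ∀ q t → suc t ≤ count≥ q μ → q ≤ part μ (suc t)
<count≥⇒≤part {x ∷ μ} l q t p with q ≤? x
<count≥⇒≤part {x ∷ μ} l q zero p | yes q≤x = q≤x
<count≥⇒≤part {x ∷ μ} l q (suc t) p | yes q≤x
  rewrite part-∷-suc x μ t | filter-accept (q ≤?_) {x} {μ} q≤x
  = <count≥⇒≤part (Linked-tail l) q t (s≤s⁻¹ p)
... | no q≰x rewrite filter-reject (q ≤?_) {x} {μ} q≰x
                   | filter-none (q ≤?_) (All.map (λ y≤x q≤y → q≰x (≤-trans q≤y y≤x)) (tail≤head l))
  = ⊥-elim (<⇒≱ (s≤s z≤n) p)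

count≤ : ℕ → List ℕ → ℕ
count≤ k xs = length (filter (_≤? k) xs)

count-++ : (n : ℕ) (xs ys : List ℕ) → count n (xs ++ ys) ≡ count n xs + count n ys
count-++ n xs ys rewrite filter-++ (n ≟_) xs ys = length-++ (filter (n ≟_) xs)

count-replicate-self : (n c : ℕ) → count n (replicate c n) ≡ c
count-replicate-self n zero = refl
count-replicate-self n (suc c) rewrite filter-accept (n ≟_) {n} {replicate c n} refl = cong suc (count-replicate-self n c)

count-replicate-other : (n a c : ℕ) → n ≢ a → count n (replicate c a) ≡ 0
count-replicate-other n a zero _ = refl
count-replicate-other n a (suc c) n≢a rewrite filter-reject (n ≟_) {a} {replicate c a} n≢a
  = count-replicate-other n a c n≢a

count-none : (n : ℕ) {xs : List ℕ} → All (n ≢_) xs → count n xs ≡ 0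
count-none n ps = cong length (filter-none (n ≟_) ps)

count-all : (n : ℕ) {xs : List ℕ} → All (_≡ n) xs → count n xs ≡ length xs
count-all n ps = cong length (filter-all (n ≟_) (All.map sym ps))

count≤-none : (k : ℕ) {xs : List ℕ} → All (k <_) xs → count≤ k xs ≡ 0
count≤-none k ps = cong length (filter-none (_≤? k) (All.map <⇒≱ ps))

count≤-all : (k : ℕ) {xs : List ℕ} → All (_≤ k) xs → count≤ k xs ≡ length xs
count≤-all k ps = cong length (filter-all (_≤? k) ps)

count≤-suc : (k : ℕ) (xs : List ℕ) → count≤ (suc k) xs ≡ count≤ k xs + count (suc k) xs
count≤-suc k [] = refl
count≤-suc k (x ∷ xs) with x ≤? k
... | yes x≤k rewrite filter-accept (_≤? k) {x} {xs} x≤k | filter-accept (_≤? suc k) {x} {xs} (m≤n⇒m≤1+n x≤k)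
                    | filter-reject (suc k ≟_) {x} {xs} (λ e → <⇒≱ (s≤s x≤k) (≤-reflexive e))
  = cong suc (count≤-suc k xs)
... | no x≰k with x ≟ suc k
... | yes refl rewrite filter-reject (_≤? k) {x} {xs} x≰k | filter-accept (_≤? suc k) {x} {xs} ≤-refl
                     | filter-accept (suc k ≟_) {x} {xs} refl
  = trans (cong suc (count≤-suc k xs)) (sym (+-suc _ _))
... | no x≢1+k rewrite filter-reject (_≤? k) {x} {xs} x≰k
                     | filter-reject (_≤? suc k) {x} {xs}
                         (λ x≤1+k → x≰k (s≤s⁻¹ (≤∧≢⇒< x≤1+k x≢1+k)))
                     | filter-reject (suc k ≟_) {x} {xs} (λ e → x≢1+k (sym e))
  = count≤-suc k xs

Sorted : List ℕ → Set
Sorted = AllPairs _≤_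

replicate-sorted : ∀ c x → Sorted (replicate c x)
replicate-sorted zero x = []
replicate-sorted (suc c) x = replicate⁺ c ≤-refl ∷ replicate-sorted c x

≤⇒index≤count≤ : {u : List ℕ} → Sorted u → ∀ y a k → nth u y ≡ just a → a ≤ k → y ≤ count≤ k u
≤⇒index≤count≤ {x ∷ u} (_ ∷ _) (suc zero) a k refl a≤k
  rewrite filter-accept (_≤? k) {x} {u} a≤k = s≤s z≤n
≤⇒index≤count≤ {x ∷ u} (x≤ ∷ s) (suc (suc y)) a k e a≤k
  rewrite filter-accept (_≤? k) {x} {u} (≤-trans (All.lookup x≤ (nth≡just⇒∈ {u = u} {suc y} e)) a≤k)
  = s≤s (≤⇒index≤count≤ s (suc y) a k e a≤k)

index≤count≤⇒≤ : {u : List ℕ} → Sorted u → ∀ y a k → nth u y ≡ just a → y ≤ count≤ k u → a ≤ k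
index≤count≤⇒≤ {x ∷ u} (x≤ ∷ s) (suc y) a k e q with x ≤? k
index≤count≤⇒≤ {x ∷ u} (x≤ ∷ s) (suc zero) a k refl q | yes x≤k = x≤k
index≤count≤⇒≤ {x ∷ u} (x≤ ∷ s) (suc (suc y)) a k e q | yes x≤k
  rewrite filter-accept (_≤? k) {x} {u} x≤k = index≤count≤⇒≤ s (suc y) a k e (s≤s⁻¹ q)
... | no x≰k rewrite filter-reject (_≤? k) {x} {u} x≰k
                   | count≤-none k (All.map (<-≤-trans (≰⇒> x≰k)) x≤)
  = ⊥-elim (<⇒≱ (s≤s z≤n) q)

Sorted-nth : {u : List ℕ} → Sorted u → ∀ y a b → nth u y ≡ just a → nth u (suc y) ≡ just b → a ≤ b
Sorted-nth {x ∷ u} (x≤ ∷ s) (suc zero) a b refl e = All.lookup x≤ (nth≡just⇒∈ {u = u} {1} e)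
Sorted-nth {x ∷ u} (x≤ ∷ s) (suc (suc y)) a b e e' = Sorted-nth s (suc y) a b e e'

nth-monotone⇒Sorted : (u : List ℕ) →
  (∀ y a b → nth u y ≡ just a → nth u (suc y) ≡ just b → a ≤ b) → Sorted u
nth-monotone⇒Sorted u mono = Linked⇒AllPairs ≤-trans (linked u mono)
  where
  linked : (u : List ℕ) → (∀ y a b → nth u y ≡ just a → nth u (suc y) ≡ just b → a ≤ b) → Linked _≤_ u
  linked [] _ = []
  linked (x ∷ []) _ = [-]
  linked (x ∷ y ∷ u) mono = mono 1 x y refl refl ∷ linked (y ∷ u) λ where
    zero a b () _
    (suc z) a b e e' → mono (suc (suc z)) a b e e'

-- Two consecutive rows u (above) and v (below) of a skew tableau whose cells start after columns m and m'.
ColumnStrict : List ℕ → List ℕ → ℕ → ℕ → Set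
ColumnStrict u v m m' = ∀ x a b → nth u (x ∸ m) ≡ just a → nth v (x ∸ m') ≡ just b → a < b

pos∸⇒≤ : ∀ x m → 1 ≤ x ∸ m → m ≤ x
pos∸⇒≤ x m p with m ≤? x
... | yes m≤x = m≤x
... | no m≰x = ⊥-elim (<⇒≱ (s≤s z≤n) (subst (1 ≤_) (m≤n⇒m∸n≡0 (<⇒≤ (≰⇒> m≰x))) p))

-- The cells of v with entry ≤ k+1 lie strictly to the left of the cells of u with entry > k.
Covers : List ℕ → List ℕ → ℕ → ℕ → ℕ → Set
Covers u v m m' k = m' + count≤ (suc k) v ≤ m + count≤ k u

Covers⇒ColumnStrict : ∀ {u v m m' ℓ} → Sorted u → Sorted v → m' ≤ m →
  All (λ b → 1 ≤ b × b ≤ ℓ) v →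
  (∀ k → k < ℓ → Covers u v m m' k) → ColumnStrict u v m m'
Covers⇒ColumnStrict {u} {v} {m} {m'} su sv m'≤m bounds cover x a b ea eb
  with All.lookup bounds (nth≡just⇒∈ {u = v} {x ∸ m'} eb)
... | 1≤b , b≤ℓ with b | 1≤b
... | suc k | _ = s≤s (index≤count≤⇒≤ su (x ∸ m) a k ea (+-cancelˡ-≤ m _ _ x≤m+count))
  where
  m≤x : m ≤ x
  m≤x = pos∸⇒≤ x m (proj₁ (nth≡just⇒inRange {u = u} {x ∸ m} ea))
  x≤m+count : m + (x ∸ m) ≤ m + count≤ k u
  x≤m+count = begin
    m + (x ∸ m)   ≡⟨ m+[n∸m]≡n m≤x ⟩
    x             ≡⟨ m+[n∸m]≡n (≤-trans m'≤m m≤x) ⟨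
    m' + (x ∸ m') ≤⟨ +-monoʳ-≤ m' (≤⇒index≤count≤ sv (x ∸ m') (suc k) (suc k) eb ≤-refl) ⟩
    m' + count≤ (suc k) v ≤⟨ cover k b≤ℓ ⟩
    m + count≤ k u ∎
    where open ≤-Reasoning

ColumnStrict⇒Covers : ∀ {u v m m'} → Sorted u → Sorted v → m' ≤ m → m' + length v ≤ m + length u →
  ColumnStrict u v m m' → ∀ k → Covers u v m m' k
ColumnStrict⇒Covers {u} {v} {m} {m'} su sv m'≤m lens cs k with count≤ (suc k) v in eqc
... | zero = +-mono-≤ m'≤m z≤n
... | suc c with nth-inRange v (suc c) (s≤s z≤n) (subst (_≤ length v) eqc (length-filter (_≤? suc k) v))
... | b , eb with m' + suc c ≤? m
... | yes p = ≤-trans p (m≤m+n m _)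
... | no p with (m' + suc c) ∸ m ≤? length u
... | yes q = subst (_≤ m + count≤ k u) (m+[n∸m]≡n m≤x)
                    (+-monoʳ-≤ m (≤⇒index≤count≤ su (x ∸ m) a k ea a≤k))
  where
  x = m' + suc c
  m≤x = <⇒≤ (≰⇒> p)
  a-def = nth-inRange u (x ∸ m) (m<n⇒0<n∸m (≰⇒> p)) q
  a = proj₁ a-def
  ea = proj₂ a-def
  a<b : a < b
  a<b = cs x a b ea (trans (cong (nth v) (m+n∸m≡n m' (suc c))) eb)
  a≤k : a ≤ k
  a≤k = s≤s⁻¹ (<-≤-trans a<b (index≤count≤⇒≤ sv (suc c) b (suc k) eb (≤-reflexive (sym eqc))))
... | no q = ⊥-elim (<⇒≱ m+|u|<x (≤-trans x≤m'+|v| lens))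
  where
  x = m' + suc c
  m+|u|<x : m + length u < x
  m+|u|<x = subst (m + length u <_) (m+[n∸m]≡n (<⇒≤ (≰⇒> p))) (+-monoʳ-< m (≰⇒> q))
  x≤m'+|v| : x ≤ m' + length v
  x≤m'+|v| = +-monoʳ-≤ m' (subst (_≤ length v) eqc (length-filter (_≤? suc k) v))

-- A row of boxes, the leftmost in the column labelled L, recorded as the sorted list of column labels
-- in which each box of size s contributes s - 1 copies of its label.
labels : ℕ → List (List ℕ) → List ℕ
labels L [] = []
labels L (b ∷ bs) = labels (pred L) bs ++ replicate (pred (length b)) L

rowOf : ℕ → ℕ → List ℕ → ℕ → List (List ℕ)
rowOf L zero u s = []
rowOf L (suc m) u s = replicate (suc (count L u)) s ∷ rowOf (pred L) m u s

NonEmptyBoxes : List (List ℕ) → Set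
NonEmptyBoxes = All (λ b → 1 ≤ length b)

oneIf≤ : ℕ → ℕ → ℕ
oneIf≤ zero _ = 1
oneIf≤ (suc a) zero = 0
oneIf≤ (suc a) (suc b) = oneIf≤ a b

oneIf≤-yes : ∀ a b → a ≤ b → oneIf≤ a b ≡ 1
oneIf≤-yes zero b _ = refl
oneIf≤-yes (suc a) (suc b) (s≤s p) = oneIf≤-yes a b p

oneIf≤-no : ∀ a b → b < a → oneIf≤ a b ≡ 0
oneIf≤-no (suc a) zero _ = refl
oneIf≤-no (suc a) (suc b) (s≤s p) = oneIf≤-no a b p

count≥≡sum-oneIf≤ : (q : ℕ) (xs : List ℕ) → count≥ q xs ≡ sum (map (oneIf≤ q) xs)
count≥≡sum-oneIf≤ q [] = refl
count≥≡sum-oneIf≤ q (x ∷ xs) with q ≤? x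
... | yes p rewrite filter-accept (q ≤?_) {x} {xs} p | oneIf≤-yes q x p = cong suc (count≥≡sum-oneIf≤ q xs)
... | no p rewrite filter-reject (q ≤?_) {x} {xs} p | oneIf≤-no q x (≰⇒> p) = count≥≡sum-oneIf≤ q xs

labels-bounds : (L : ℕ) (r : List (List ℕ)) → All (λ a → a ≤ L × L < a + length r) (labels L r)
labels-bounds L [] = []
labels-bounds L (b ∷ bs) =
  ++⁺ (All.map shift (labels-bounds (pred L) bs)) (replicate⁺ _ (≤-refl , m<m+n L (s≤s z≤n)))
  where
  n≤1+pred[n] : ∀ n → n ≤ suc (pred n)
  n≤1+pred[n] zero = z≤n
  n≤1+pred[n] (suc n) = ≤-refl
  shift : ∀ {a} → a ≤ pred L × pred L < a + length bs → a ≤ L × L < a + suc (length bs)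
  shift {a} (p , q) =
    ≤-trans p pred[n]≤n , subst (L <_) (sym (+-suc a (length bs))) (s≤s (≤-trans (n≤1+pred[n] L) q))

labels-pos : ∀ L r → length r ≤ L → All (1 ≤_) (labels L r)
labels-pos L r |r|≤L = All.map pos (labels-bounds L r)
  where
  pos : ∀ {a} → a ≤ L × L < a + length r → 1 ≤ a
  pos {zero} (_ , q) = ⊥-elim (<⇒≱ q |r|≤L)
  pos {suc a} _ = s≤s z≤n

labels-sorted : (L : ℕ) (r : List (List ℕ)) → Sorted (labels L r)
labels-sorted L [] = []
labels-sorted L (b ∷ bs) =
  AllPairs.++⁺ (labels-sorted (pred L) bs) (replicate-sorted _ L)
    (All.map (λ q → replicate⁺ _ (≤-trans (proj₁ q) pred[n]≤n)) (labels-bounds (pred L) bs))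

sum-sizes≡boxes+labels : (L : ℕ) (r : List (List ℕ)) → NonEmptyBoxes r →
                         sum (map length r) ≡ length r + length (labels L r)
sum-sizes≡boxes+labels L [] _ = refl
sum-sizes≡boxes+labels L (b ∷ bs) (p ∷ ps)
  rewrite length-++ (labels (pred L) bs) {replicate (pred (length b)) L} | length-replicate (pred (length b)) {L}
        | sum-sizes≡boxes+labels (pred L) bs ps | sym (suc-pred (length b) {{>-nonZero p}})
  = arith (pred (length b)) (length bs) (length (labels (pred L) bs))
  where
  arith : ∀ a b c → suc a + (b + c) ≡ suc (b + (c + a))
  arith = solve-∀

count-head-labels : ∀ L' b bs → count (suc L') (labels (suc L') (b ∷ bs)) ≡ pred (length b)
count-head-labels L' b bs
  rewrite count-++ (suc L') (labels L' bs) (replicate (pred (length b)) (suc L'))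
        | count-replicate-self (suc L') (pred (length b))
        | count-none (suc L') (All.map (λ q e → <⇒≱ (s≤s (proj₁ q)) (≤-reflexive e)) (labels-bounds L' bs))
  = refl

count-tail-labels : ∀ L' b bs a → a ≤ L' → count a (labels (suc L') (b ∷ bs)) ≡ count a (labels L' bs)
count-tail-labels L' b bs a a≤L'
  rewrite count-++ a (labels L' bs) (replicate (pred (length b)) (suc L'))
        | count-replicate-other a (suc L') (pred (length b)) (λ e → <⇒≱ (s≤s a≤L') (≤-reflexive (sym e)))
  = +-identityʳ _

-- The box in the column labelled L - d has size 1 + (number of labels L - d), when it exists.
length-box : (L d : ℕ) (r : List (List ℕ)) → NonEmptyBoxes r → d < L →
             length (nthL r (suc d)) ≡ oneIf≤ (suc d) (length r) + count (L ∸ d) (labels L r)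
length-box L d [] _ _ rewrite nthL-[] {ℕ} (suc d) = refl
length-box (suc L') zero (b ∷ bs) (p ∷ _) _
  rewrite count-head-labels L' b bs = sym (suc-pred (length b) {{>-nonZero p}})
length-box (suc L') (suc d) (b ∷ bs) (_ ∷ ps) (s≤s d<L')
  rewrite nthL-∷-suc b bs d | count-tail-labels L' b bs (L' ∸ d) (m∸n≤m L' d) = length-box L' d bs ps d<L'

length-rowOf : (L m : ℕ) (u : List ℕ) (s : ℕ) → length (rowOf L m u s) ≡ m
length-rowOf L zero u s = refl
length-rowOf L (suc m) u s = cong suc (length-rowOf (pred L) m u s)

rowOf-cong : (L m : ℕ) (u v : List ℕ) (s : ℕ) → (∀ a → a ≤ L → count a u ≡ count a v) →
             rowOf L m u s ≡ rowOf L m v s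
rowOf-cong L zero u v s e = refl
rowOf-cong L (suc m) u v s e =
  cong₂ _∷_ (cong (λ c → replicate (suc c) s) (e L ≤-refl))
            (rowOf-cong (pred L) m u v s (λ a a≤ → e a (≤-trans a≤ pred[n]≤n)))

replicate-length : (s : ℕ) {b : List ℕ} → All (_≡ s) b → replicate (length b) s ≡ b
replicate-length s [] = refl
replicate-length s (refl ∷ ps) = cong (s ∷_) (replicate-length s ps)

rowOf-labels : (L s : ℕ) (r : List (List ℕ)) → NonEmptyBoxes r → All (All (_≡ s)) r → length r ≤ L →
               rowOf L (length r) (labels L r) s ≡ r
rowOf-labels L s [] _ _ _ = refl
rowOf-labels (suc L') s (b ∷ bs) (p ∷ ps) (q ∷ qs) (s≤s |bs|≤L') = cong₂ _∷_ head-box rest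
  where
  head-box : replicate (suc (count (suc L') (labels (suc L') (b ∷ bs)))) s ≡ b
  head-box rewrite count-head-labels L' b bs =
    trans (cong (λ c → replicate c s) (suc-pred (length b) {{>-nonZero p}})) (replicate-length s q)
  rest : rowOf L' (length bs) (labels (suc L') (b ∷ bs)) s ≡ bs
  rest = trans (rowOf-cong L' (length bs) _ _ s (count-tail-labels L' b bs)) (rowOf-labels L' s bs ps qs |bs|≤L')

count-filter≤ : ∀ L' a → a ≤ L' → ∀ u → count a (filter (_≤? L') u) ≡ count a u
count-filter≤ L' a a≤L' [] = refl
count-filter≤ L' a a≤L' (x ∷ u) with x ≤? L'
... | yes p rewrite filter-accept (_≤? L') {x} {u} p with a ≟ x
... | yes q rewrite filter-accept (a ≟_) {x} {filter (_≤? L') u} q | filter-accept (a ≟_) {x} {u} q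
  = cong suc (count-filter≤ L' a a≤L' u)
... | no q rewrite filter-reject (a ≟_) {x} {filter (_≤? L') u} q | filter-reject (a ≟_) {x} {u} q
  = count-filter≤ L' a a≤L' u
count-filter≤ L' a a≤L' (x ∷ u) | no p rewrite filter-reject (_≤? L') {x} {u} p
  | filter-reject (a ≟_) {x} {u} (λ e → p (subst (_≤ L') e a≤L')) = count-filter≤ L' a a≤L' u

squeezed-top : ∀ {L' x u} → ¬ x ≤ L' → All (x ≤_) u → All (_≤ suc L') u → All (_≡ suc L') u
squeezed-top x≰L' x≤ ≤top =
  All.zipWith (λ (x≤a , a≤top) → ≤-antisym a≤top (≤-trans (≰⇒> x≰L') x≤a)) (x≤ , ≤top)

split-top : ∀ L' {u : List ℕ} → Sorted u → All (_≤ suc L') u →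
            u ≡ filter (_≤? L') u ++ replicate (count (suc L') u) (suc L')
split-top L' {[]} _ _ = refl
split-top L' {x ∷ u} (x≤ ∷ s) (q ∷ qs) with x ≤? L'
... | yes p rewrite filter-accept (_≤? L') {x} {u} p
                  | filter-reject (suc L' ≟_) {x} {u} (λ e → <⇒≱ (s≤s p) (≤-reflexive e))
  = cong (x ∷_) (split-top L' s qs)
... | no p with refl ← ≤-antisym q (≰⇒> p)
  rewrite filter-reject (_≤? L') {suc L'} {u} p | filter-accept (suc L' ≟_) {suc L'} {u} refl
        | filter-none (_≤? L') (All.map (λ e le → <⇒≱ (≤-reflexive (sym e)) le) (squeezed-top p x≤ qs))
        | count-all (suc L') (squeezed-top p x≤ qs)
  = cong (suc L' ∷_) (sym (replicate-length (suc L') (squeezed-top p x≤ qs)))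

labels-rowOf : (L m : ℕ) {u : List ℕ} → Sorted u → All (λ a → a ≤ L × L < a + m) u → m ≤ L → ∀ s →
               labels L (rowOf L m u s) ≡ u
labels-rowOf L zero {[]} _ _ _ s = refl
labels-rowOf L zero {x ∷ u} _ ((p , q) ∷ _) _ s = ⊥-elim (<⇒≱ (subst (L <_) (+-identityʳ x) q) p)
labels-rowOf (suc L') (suc m) {u} su bounds (s≤s m≤L') s =
  begin
    labels L' (rowOf L' m u s) ++ replicate (length (replicate (count (suc L') u) s)) (suc L')
      ≡⟨ cong (λ z → labels L' z ++ replicate (length (replicate (count (suc L') u) s)) (suc L'))
              (rowOf-cong L' m u u' s (λ a a≤ → sym (count-filter≤ L' a a≤ u))) ⟩
    labels L' (rowOf L' m u' s) ++ replicate (length (replicate (count (suc L') u) s)) (suc L')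
      ≡⟨ cong₂ _++_ (labels-rowOf L' m (AllPairs.filter⁺ (_≤? L') su) bounds' m≤L' s)
                    (cong (λ c → replicate c (suc L')) (length-replicate (count (suc L') u))) ⟩
    u' ++ replicate (count (suc L') u) (suc L')
      ≡⟨ split-top L' su (All.map proj₁ bounds) ⟨
    u ∎
  where
  open ≡-Reasoning
  u' = filter (_≤? L') u
  bounds' : All (λ a → a ≤ L' × L' < a + m) u'
  bounds' = All.map (λ {a} (in-range , a≤L') → a≤L' , s≤s⁻¹ (subst (suc L' <_) (+-suc a m) (proj₂ in-range)))
                    (All.zip (filter⁺ (_≤? L') bounds , all-filter (_≤? L') u))

boxSize : ℕ → List (List ℕ) → ℕ → ℕ
boxSize ℓ r zero = 0
boxSize ℓ r (suc j) = length (nthL r (ℓ ∸ j))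

boxSum : ℕ → List (List ℕ) → ℕ → ℕ
boxSum ℓ r k = sumTo k (boxSize ℓ r)

bsize≡boxSize : ∀ ℓ P i j → bsize ℓ P i j ≡ boxSize ℓ (nthL P i) j
bsize≡boxSize ℓ P i zero = refl
bsize≡boxSize ℓ P i (suc j) = refl

sumTo-cong : (k : ℕ) {f g : ℕ → ℕ} → (∀ j → f j ≡ g j) → sumTo k f ≡ sumTo k g
sumTo-cong zero e = refl
sumTo-cong (suc k) e = cong₂ _+_ (sumTo-cong k e) (e (suc k))

sumTo-shift : (f : ℕ → ℕ) (k : ℕ) → sumTo (suc k) (λ j → f (j ∸ 1)) ≡ f 0 + sumTo k f
sumTo-shift f zero = +-comm 0 (f 0)
sumTo-shift f (suc k) = trans (cong (_+ f (suc k)) (sumTo-shift f k)) (+-assoc (f 0) _ _)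

-- The box in column k'+1 exists iff k'+1 > ℓ - m, where ℓ = k' + 1 + d.
oneIf≤-∸-step : ∀ k' d m → m ≤ suc k' + d →
  oneIf≤ (suc d) m + (k' ∸ ((suc k' + d) ∸ m)) ≡ suc k' ∸ ((suc k' + d) ∸ m)
oneIf≤-∸-step k' d m m≤ℓ with suc d ≤? m
... | yes p = trans (cong (_+ (k' ∸ ((suc k' + d) ∸ m))) (oneIf≤-yes (suc d) m p)) (sym (+-∸-assoc 1 ℓ-m≤k'))
  where
  ℓ-m≤k' : (suc k' + d) ∸ m ≤ k'
  ℓ-m≤k' = subst ((suc k' + d) ∸ m ≤_) (trans (cong (_∸ suc d) (sym (+-suc k' d))) (m+n∸n≡m k' (suc d)))
                 (∸-monoʳ-≤ (suc k' + d) p)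
... | no p = trans (cong₂ _+_ (oneIf≤-no (suc d) m (≰⇒> p)) (m≤n⇒m∸n≡0 (≤-trans (n≤1+n k') k'<ℓ-m)))
                   (sym (m≤n⇒m∸n≡0 k'<ℓ-m))
  where
  k'<ℓ-m : suc k' ≤ (suc k' + d) ∸ m
  k'<ℓ-m = subst (_≤ (suc k' + d) ∸ m) (m+n∸n≡m (suc k') d) (∸-monoʳ-≤ (suc k' + d) (s≤s⁻¹ (≰⇒> p)))

-- Over the columns 1..k there are k - (ℓ - |r|) boxes, and their sizes beyond 1 are counted by the labels ≤ k.
boxSum≡ : (ℓ : ℕ) (r : List (List ℕ)) → NonEmptyBoxes r → length r ≤ ℓ → ∀ k → k ≤ ℓ →
          boxSum ℓ r k ≡ (k ∸ (ℓ ∸ length r)) + count≤ k (labels ℓ r)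
boxSum≡ ℓ r ne |r|≤ℓ zero _ =
  sym (cong₂ _+_ (0∸n≡0 (ℓ ∸ length r)) (count≤-none 0 (labels-pos ℓ r |r|≤ℓ)))
boxSum≡ ℓ r ne |r|≤ℓ (suc k') k<ℓ = begin
    boxSum ℓ r k' + length (nthL r (ℓ ∸ k'))
      ≡⟨ cong₂ _+_ (boxSum≡ ℓ r ne |r|≤ℓ k' (≤-trans (n≤1+n k') k<ℓ)) box ⟩
    ((k' ∸ D) + count≤ k' ls) + (oneIf≤ (suc d) m + count (suc k') ls)
      ≡⟨ regroup (k' ∸ D) (count≤ k' ls) (oneIf≤ (suc d) m) (count (suc k') ls) ⟩
    (oneIf≤ (suc d) m + (k' ∸ D)) + (count≤ k' ls + count (suc k') ls)
      ≡⟨ cong₂ _+_ boxes (sym (count≤-suc k' ls)) ⟩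
    (suc k' ∸ D) + count≤ (suc k') ls ∎
  where
  open ≡-Reasoning
  m = length r
  D = ℓ ∸ m
  ls = labels ℓ r
  d = ℓ ∸ suc k'
  ℓ≡ : ℓ ≡ suc k' + d
  ℓ≡ = sym (m+[n∸m]≡n k<ℓ)
  box : length (nthL r (ℓ ∸ k')) ≡ oneIf≤ (suc d) m + count (suc k') ls
  box = subst₂ (λ p c → length (nthL r p) ≡ oneIf≤ (suc d) m + count c ls)
          (sym (+-∸-assoc 1 k<ℓ)) (m∸[m∸n]≡n k<ℓ)
          (length-box ℓ d r ne (subst (d <_) (sym ℓ≡) (s≤s (m≤n+m d k'))))
  boxes : oneIf≤ (suc d) m + (k' ∸ D) ≡ suc k' ∸ D
  boxes = subst (λ L → oneIf≤ (suc d) m + (k' ∸ (L ∸ m)) ≡ suc k' ∸ (L ∸ m)) (sym ℓ≡)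
            (oneIf≤-∸-step k' d m (subst (m ≤_) ℓ≡ |r|≤ℓ))
  regroup : ∀ a b c e → (a + b) + (c + e) ≡ (c + a) + (b + e)
  regroup = solve-∀

boxSum-beyond : ∀ ℓ r e → boxSum ℓ r (ℓ + e) ≡ boxSum ℓ r ℓ
boxSum-beyond ℓ r zero = cong (boxSum ℓ r) (+-identityʳ ℓ)
boxSum-beyond ℓ r (suc e) rewrite +-suc ℓ e | m≤n⇒m∸n≡0 (m≤m+n ℓ e)
  = trans (+-identityʳ _) (boxSum-beyond ℓ r e)

boxSum-total : (ℓ : ℕ) (r : List (List ℕ)) → NonEmptyBoxes r → length r ≤ ℓ → ∀ k → ℓ ≤ k →
               boxSum ℓ r k ≡ length r + count≤ k (labels ℓ r)
boxSum-total ℓ r ne |r|≤ℓ k ℓ≤k = begin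
    boxSum ℓ r k                                   ≡⟨ cong (boxSum ℓ r) (m+[n∸m]≡n ℓ≤k) ⟨
    boxSum ℓ r (ℓ + (k ∸ ℓ))                       ≡⟨ boxSum-beyond ℓ r (k ∸ ℓ) ⟩
    boxSum ℓ r ℓ                                   ≡⟨ boxSum≡ ℓ r ne |r|≤ℓ ℓ ≤-refl ⟩
    (ℓ ∸ (ℓ ∸ length r)) + count≤ ℓ (labels ℓ r)  ≡⟨ cong₂ _+_ (m∸[m∸n]≡n |r|≤ℓ) all-counted ⟩
    length r + count≤ k (labels ℓ r)               ∎
  where
  open ≡-Reasoning
  below-ℓ = All.map proj₁ (labels-bounds ℓ r)
  all-counted : count≤ ℓ (labels ℓ r) ≡ count≤ k (labels ℓ r)
  all-counted =
    trans (count≤-all ℓ below-ℓ) (sym (count≤-all k (All.map (λ a≤ℓ → ≤-trans a≤ℓ ℓ≤k) below-ℓ)))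

+-≤-exchange : ∀ {a b a' b' x y c d} → a + x ≡ b + y → a' + x ≡ b' + y → a + c ≤ b + d → a' + c ≤ b' + d
+-≤-exchange {a} {b} {a'} {b'} {x} {y} {c} {d} e e' le = +-cancelʳ-≤ (a + x) (a' + c) (b' + d) (begin
    (a' + c) + (a + x) ≡⟨ swap a' c a x ⟩
    (a' + x) + (a + c) ≤⟨ +-mono-≤ (≤-reflexive e') le ⟩
    (b' + y) + (b + d) ≡⟨ swap b' y b d ⟩
    (b' + d) + (b + y) ≡⟨ cong ((b' + d) +_) e ⟨
    (b' + d) + (a + x) ∎)
  where
  open ≤-Reasoning
  swap : ∀ p q r s → (p + q) + (r + s) ≡ (p + s) + (r + q)
  swap = solve-∀

MaximalPair : ℕ → List (List ℕ) → List (List ℕ) → Set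
MaximalPair ℓ u v = ∀ k → boxSum ℓ v k ≤ 1 + sumTo k (λ j → boxSize ℓ u (j ∸ 1))

maximality⇔MaximalPair : ∀ ℓ P i →
  (∀ k → sumTo k (λ j → bsize ℓ P (suc (suc i)) j) ≤ 1 + sumTo k (λ j → bsize ℓ P (suc i) (j ∸ 1)))
  ⇔ MaximalPair ℓ (nthL P (suc i)) (nthL P (suc (suc i)))
maximality⇔MaximalPair ℓ P i = mk⇔ (λ max k → subst₂ _≤_ (lower k) (cong suc (upper k)) (max k))
                                   (λ max k → subst₂ _≤_ (sym (lower k)) (cong suc (sym (upper k))) (max k))
  where
  lower : ∀ k → sumTo k (bsize ℓ P (suc (suc i))) ≡ boxSum ℓ (nthL P (suc (suc i))) k
  lower k = sumTo-cong k (bsize≡boxSize ℓ P (suc (suc i)))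
  upper : ∀ k → sumTo k (λ j → bsize ℓ P (suc i) (j ∸ 1)) ≡ sumTo k (λ j → boxSize ℓ (nthL P (suc i)) (j ∸ 1))
  upper k = sumTo-cong k (λ j → bsize≡boxSize ℓ P (suc i) (j ∸ 1))

module _ (ℓ : ℕ) (u v : List (List ℕ)) (neu : NonEmptyBoxes u) (nev : NonEmptyBoxes v)
         (|v|≤|u| : length v ≤ length u) (|u|≤ℓ : length u ≤ ℓ) where

  private
    m = length u
    m' = length v
    |v|≤ℓ = ≤-trans |v|≤|u| |u|≤ℓ

  labels-vanish : ∀ k → suc k ≤ ℓ ∸ m' → count≤ (suc k) (labels ℓ v) ≡ 0
  labels-vanish k k<ℓ-m' = count≤-none (suc k) (All.map above (labels-bounds ℓ v))
    where
    above : ∀ {a} → a ≤ ℓ × ℓ < a + m' → suc k < a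
    above {a} (_ , ℓ<a+m') =
      <-≤-trans (s≤s k<ℓ-m') (subst (ℓ ∸ m' <_) (m+n∸n≡m a m') (∸-monoˡ-< ℓ<a+m' |v|≤ℓ))

  maximalStep⇔Covers : ∀ k → k < ℓ →
    boxSum ℓ v (suc k) ≤ suc (boxSum ℓ u k) ⇔ Covers (labels ℓ u) (labels ℓ v) m m' k
  maximalStep⇔Covers k k<ℓ
    rewrite boxSum≡ ℓ v nev |v|≤ℓ (suc k) k<ℓ | boxSum≡ ℓ u neu |u|≤ℓ k (<⇒≤ k<ℓ)
    with suc k ≤? ℓ ∸ m'
  ... | yes k<ℓ-m' rewrite labels-vanish k k<ℓ-m' | m≤n⇒m∸n≡0 k<ℓ-m'
    = mk⇔ (λ _ → +-mono-≤ |v|≤|u| z≤n) (λ _ → z≤n)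
  ... | no k≮ℓ-m' = mk⇔ (+-≤-exchange {c = Cv} {d = Cu} columns rows)
                         (+-≤-exchange {c = Cv} {d = Cu} rows columns)
    where
    Cv = count≤ (suc k) (labels ℓ v)
    Cu = count≤ k (labels ℓ u)
    ℓ-m'≤k = s≤s⁻¹ (≰⇒> k≮ℓ-m')
    columns : (suc k ∸ (ℓ ∸ m')) + (ℓ ∸ m') ≡ suc ((k ∸ (ℓ ∸ m)) + (ℓ ∸ m))
    columns = trans (m∸n+n≡m (≤-trans ℓ-m'≤k (n≤1+n k)))
                    (cong suc (sym (m∸n+n≡m (≤-trans (∸-monoʳ-≤ ℓ |v|≤|u|) ℓ-m'≤k))))
    rows : m' + (ℓ ∸ m') ≡ m + (ℓ ∸ m)
    rows = trans (m+[n∸m]≡n |v|≤ℓ) (sym (m+[n∸m]≡n |u|≤ℓ))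

  MaximalPair⇒Covers : MaximalPair ℓ u v → ∀ k → k < ℓ → Covers (labels ℓ u) (labels ℓ v) m m' k
  MaximalPair⇒Covers max k k<ℓ =
    Equivalence.to (maximalStep⇔Covers k k<ℓ)
      (subst (boxSum ℓ v (suc k) ≤_) (cong suc (sumTo-shift (boxSize ℓ u) k)) (max (suc k)))

  Covers⇒MaximalPair : (∀ k → Covers (labels ℓ u) (labels ℓ v) m m' k) → MaximalPair ℓ u v
  Covers⇒MaximalPair cover zero = z≤n
  Covers⇒MaximalPair cover (suc k) =
    subst (boxSum ℓ v (suc k) ≤_) (sym (cong suc (sumTo-shift (boxSize ℓ u) k))) step
    where
    step : boxSum ℓ v (suc k) ≤ suc (boxSum ℓ u k)
    step with k <? ℓ
    ... | yes k<ℓ = Equivalence.from (maximalStep⇔Covers k k<ℓ) (cover k)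
    ... | no k≮ℓ = subst₂ (λ a b → a ≤ suc b)
                     (sym (boxSum-total ℓ v nev |v|≤ℓ (suc k) (≤-trans ℓ≤k (n≤1+n k))))
                     (sym (boxSum-total ℓ u neu |u|≤ℓ k ℓ≤k)) (m≤n⇒m≤1+n (cover k))
      where ℓ≤k = ≮⇒≥ k≮ℓ

RowsFilledFrom : ℕ → Tab → Set
RowsFilledFrom s [] = ⊤
RowsFilledFrom s (r ∷ P) = All (All (_≡ s)) r × RowsFilledFrom (suc s) P

RowsFilledFrom-nthL : ∀ s (P : Tab) → (∀ t → All (All (_≡ s + t)) (nthL P (suc t))) → RowsFilledFrom s P
RowsFilledFrom-nthL s [] f = tt
RowsFilledFrom-nthL s (r ∷ P) f =
  subst (λ n → All (All (_≡ n)) r) (+-identityʳ s) (f 0) ,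
  RowsFilledFrom-nthL (suc s) P λ t →
    subst₂ (λ n row → All (All (_≡ n)) row) (+-suc s t) (nthL-∷-suc r P t) (f (suc t))

BoxAt≡i⇒row-filled : (P : Tab) → (∀ i p x → x ∈ BoxAt P i p → x ≡ i) →
                     ∀ t → All (All (_≡ suc t)) (nthL P (suc t))
BoxAt≡i⇒row-filled P e t = All.tabulate λ {b} b∈row → All.tabulate λ {x} x∈b →
  let (p , box-p) = ∈⇒nthL≡ b∈row in e (suc t) (suc p) x (subst (x ∈_) (sym box-p) x∈b)

BoxAt≡i⇒RowsFilledFrom1 : (P : Tab) → (∀ i p x → x ∈ BoxAt P i p → x ≡ i) → RowsFilledFrom 1 P
BoxAt≡i⇒RowsFilledFrom1 P e = RowsFilledFrom-nthL 1 P (BoxAt≡i⇒row-filled P e)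

count-row-self : (s : ℕ) (r : List (List ℕ)) → All (All (_≡ s)) r → sum (map (count s) r) ≡ sum (map length r)
count-row-self s [] _ = refl
count-row-self s (b ∷ r) (p ∷ ps) = cong₂ _+_ (count-all s p) (count-row-self s r ps)

count-row-other : (n s : ℕ) (r : List (List ℕ)) → n ≢ s → All (All (_≡ s)) r → sum (map (count n) r) ≡ 0
count-row-other n s [] _ _ = refl
count-row-other n s (b ∷ r) n≢s (p ∷ ps) =
  cong₂ _+_ (count-none n (All.map (λ x≡s n≡x → n≢s (trans n≡x x≡s)) p)) (count-row-other n s r n≢s ps)

wtMT-below : ∀ s (P : Tab) → RowsFilledFrom s P → ∀ n → n < s → wtMT P n ≡ 0
wtMT-below s [] _ n _ = refl
wtMT-below s (r ∷ P) (rr , rs) n n<s =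
  cong₂ _+_ (count-row-other n s r (<⇒≢ n<s) rr) (wtMT-below (suc s) P rs n (m≤n⇒m≤1+n n<s))

wtMT-row : ∀ s (P : Tab) → RowsFilledFrom s P → ∀ t → wtMT P (s + t) ≡ sum (map length (nthL P (suc t)))
wtMT-row s [] _ t = refl
wtMT-row s (r ∷ P) (rr , rs) zero rewrite +-identityʳ s =
  trans (cong₂ _+_ (count-row-self s r rr) (wtMT-below (suc s) P rs s (n<1+n s))) (+-identityʳ _)
wtMT-row s (r ∷ P) (rr , rs) (suc t) rewrite nthL-∷-suc r P t | +-suc s t =
  cong₂ _+_ (count-row-other (suc (s + t)) s r (λ e → <⇒≢ (s≤s (m≤m+n s t)) (sym e)) rr)
            (wtMT-row (suc s) P rs t)

wtMT-beyond : (P : Tab) → RowsFilledFrom 1 P → ∀ n → length P < n → wtMT P n ≡ 0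
wtMT-beyond P filled (suc t) |P|<n =
  trans (wtMT-row 1 P filled t) (cong (λ r → sum (map length r)) (nthL-beyond P (suc t) |P|<n))

wtMT≡boxes+labels : ∀ ℓ P → RowsFilledFrom 1 P → All NonEmptyBoxes P → ∀ t →
                    wtMT P (suc t) ≡ length (nthL P (suc t)) + length (labels ℓ (nthL P (suc t)))
wtMT≡boxes+labels ℓ P filled nonEmpty t =
  trans (wtMT-row 1 P filled t) (sum-sizes≡boxes+labels ℓ (nthL P (suc t)) (All-nthL nonEmpty [] (suc t)))

-- Each box contributes 1 to its column's count and its labels to the column's weight in R.
colEntries≡colLen+wtRT : (ℓ n : ℕ) (P : Tab) → All NonEmptyBoxes P → 1 ≤ n → n ≤ ℓ →
                         colEntries ℓ P n ≡ colLen ℓ (map length P) n + wtRT (map (labels ℓ) P) n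
colEntries≡colLen+wtRT ℓ n [] _ _ _ = refl
colEntries≡colLen+wtRT ℓ n (r ∷ P) (ne ∷ nes) 1≤n n≤ℓ = begin
    length (nthL r (suc ℓ ∸ n)) + colEntries ℓ P n
      ≡⟨ cong₂ _+_ box (colEntries≡colLen+wtRT ℓ n P nes 1≤n n≤ℓ) ⟩
    (one r + count n (labels ℓ r)) + (colLen ℓ (map length P) n + wtRT (map (labels ℓ) P) n)
      ≡⟨ cong (λ c → (one r + count n (labels ℓ r)) + (c + wtRT (map (labels ℓ) P) n))
              (count≥≡sum-oneIf≤ q (map length P)) ⟩
    (one r + count n (labels ℓ r)) + (ones P + wtRT (map (labels ℓ) P) n)
      ≡⟨ regroup (one r) (count n (labels ℓ r)) (ones P) (wtRT (map (labels ℓ) P) n) ⟩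
    (one r + ones P) + (count n (labels ℓ r) + wtRT (map (labels ℓ) P) n)
      ≡⟨ cong (_+ (count n (labels ℓ r) + wtRT (map (labels ℓ) P) n))
              (count≥≡sum-oneIf≤ q (length r ∷ map length P)) ⟨
    colLen ℓ (length r ∷ map length P) n + (count n (labels ℓ r) + wtRT (map (labels ℓ) P) n) ∎
  where
  open ≡-Reasoning
  q = suc ℓ ∸ n
  one : List (List ℕ) → ℕ
  one r = oneIf≤ q (length r)
  ones : Tab → ℕ
  ones P = sum (map (oneIf≤ q) (map length P))
  box : length (nthL r q) ≡ one r + count n (labels ℓ r)
  box = subst₂ (λ p c → length (nthL r p) ≡ oneIf≤ p (length r) + count c (labels ℓ r))
          (sym (+-∸-assoc 1 n≤ℓ)) (m∸[m∸n]≡n n≤ℓ)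
          (length-box ℓ (ℓ ∸ n) r ne (∸-monoʳ-< {ℓ} {n} {zero} 1≤n n≤ℓ))
  regroup : ∀ a b c e → (a + b) + (c + e) ≡ (a + c) + (b + e)
  regroup = solve-∀

ValidBox : List ℕ → Set
ValidBox b = (b ≢ []) × Linked _≤_ b × All (1 ≤_) b

ValidBoxes⇒NonEmptyBoxes : {r : List (List ℕ)} → All ValidBox r → NonEmptyBoxes r
ValidBoxes⇒NonEmptyBoxes = All.map nonempty
  where
  nonempty : ∀ {b} → ValidBox b → 1 ≤ length b
  nonempty {[]} (b≢[] , _) = ⊥-elim (b≢[] refl)
  nonempty {_ ∷ _} _ = s≤s z≤n

rowOf-valid : ∀ L m u s → 1 ≤ s → All ValidBox (rowOf L m u s)
rowOf-valid L zero u s _ = []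
rowOf-valid L (suc m) u s 1≤s =
  ((λ ()) , AllPairs⇒Linked (replicate-sorted (suc (count L u)) s) , replicate⁺ (suc (count L u)) 1≤s)
  ∷ rowOf-valid (pred L) m u s 1≤s

rowOf-filled : ∀ L m u s → All (All (_≡ s)) (rowOf L m u s)
rowOf-filled L zero u s = []
rowOf-filled L (suc m) u s = replicate⁺ (suc (count L u)) refl ∷ rowOf-filled (pred L) m u s

tableauOf : ℕ → ℕ → List ℕ → SkewTab → Tab
tableauOf ℓ s [] R = []
tableauOf ℓ s (m ∷ μ) R = rowOf ℓ m (nthL R 1) s ∷ tableauOf ℓ (suc s) μ (drop 1 R)

nthL-tableauOf : ∀ ℓ s μ R t →
                 nthL (tableauOf ℓ s μ R) (suc t) ≡ rowOf ℓ (part μ (suc t)) (nthL R (suc t)) (s + t)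
nthL-tableauOf ℓ s [] R t = refl
nthL-tableauOf ℓ s (m ∷ μ) R zero = cong (rowOf ℓ m (nthL R 1)) (sym (+-identityʳ s))
nthL-tableauOf ℓ s (m ∷ μ) R (suc t)
  rewrite nthL-∷-suc (rowOf ℓ m (nthL R 1) s) (tableauOf ℓ (suc s) μ (drop 1 R)) t | part-∷-suc m μ t
  = trans (nthL-tableauOf ℓ (suc s) μ (drop 1 R) t)
          (cong₂ (rowOf ℓ (part μ (suc t))) (nthL-drop1 R) (sym (+-suc s t)))
  where
  nthL-drop1 : ∀ R → nthL (drop 1 R) (suc t) ≡ nthL R (suc (suc t))
  nthL-drop1 [] = refl
  nthL-drop1 (u ∷ R) = sym (nthL-∷-suc u R t)

shape-tableauOf : ∀ ℓ s μ R → map length (tableauOf ℓ s μ R) ≡ μ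
shape-tableauOf ℓ s [] R = refl
shape-tableauOf ℓ s (m ∷ μ) R =
  cong₂ _∷_ (length-rowOf ℓ m (nthL R 1) s) (shape-tableauOf ℓ (suc s) μ (drop 1 R))

tableauOf-valid : ∀ ℓ s μ R → 1 ≤ s → All (All ValidBox) (tableauOf ℓ s μ R)
tableauOf-valid ℓ s [] R _ = []
tableauOf-valid ℓ s (m ∷ μ) R 1≤s =
  rowOf-valid ℓ m (nthL R 1) s 1≤s ∷ tableauOf-valid ℓ (suc s) μ (drop 1 R) (m≤n⇒m≤1+n 1≤s)

Sorted⇒ent-monotone : {u : List ℕ} → Sorted u →
  ∀ m x a b → nth u (x ∸ m) ≡ just a → nth u (suc x ∸ m) ≡ just b → a ≤ b
Sorted⇒ent-monotone {u} su m x a b ea eb =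
  Sorted-nth su (x ∸ m) a b ea (trans (cong (nth u) (sym (+-∸-assoc 1 m≤x))) eb)
  where m≤x = pos∸⇒≤ x m (proj₁ (nth≡just⇒inRange {u = u} {x ∸ m} ea))

module Correspondence (ℓ : ℕ) (μ λ' : List ℕ) (T : Vec ℕ ℓ) (pμ : IsPartition μ) (μ₁≡ℓ : part μ 1 ≡ ℓ)
                   (pλ : IsPartition λ') (μ⊆λ : μ ⊆ₚ λ') where

  MaximalWithWeights : Tab → Set
  MaximalWithWeights P = IsMaxMT ℓ μ P
    × (∀ n → wtMT P n ≡ part λ' n)
    × (∀ j → colEntries ℓ P (suc (toℕ j)) ≡ lookup T j + colLen ℓ μ (suc (toℕ j)))

  RestrictedWithWeight : SkewTab → Set
  RestrictedWithWeight R = IsRT ℓ λ' μ R × (∀ j → wtRT R (suc (toℕ j)) ≡ lookup T j)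

  part-μ≤ℓ : ∀ i → part μ i ≤ ℓ
  part-μ≤ℓ i = subst (part μ i ≤_) μ₁≡ℓ (part≤part1 (proj₁ pμ) i)

  length-μ≤length-λ : length μ ≤ length λ'
  length-μ≤length-λ with length μ in eq
  ... | zero = z≤n
  ... | suc n = part-pos⇒≤length λ' (suc n)
                  (≤-trans (part-pos μ (proj₂ pμ) (suc n) (s≤s z≤n) (≤-reflexive (sym eq))) (μ⊆λ (suc n)))

  part-λ-pos : length μ < length λ' → 1 ≤ part λ' (length λ')
  part-λ-pos |μ|<|λ| = part-pos λ' (proj₂ pλ) (length λ') (≤-trans (s≤s z≤n) |μ|<|λ|) ≤-refl

  toRT : Tab → SkewTab
  toRT = map (labels ℓ)

  nthL-toRT : ∀ P i → nthL (toRT P) i ≡ labels ℓ (nthL P i)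
  nthL-toRT P i = nthL-map (labels ℓ) refl P i

  module Shaped (P : Tab) (shape : map length P ≡ μ) where

    rowLength : ∀ i → length (nthL P i) ≡ part μ i
    rowLength i = trans (length-nthL P i) (cong (λ ν → part ν i) shape)

    rowLength≤ℓ : ∀ i → length (nthL P i) ≤ ℓ
    rowLength≤ℓ i = subst (_≤ ℓ) (sym (rowLength i)) (part-μ≤ℓ i)

    rowLength-antitone : ∀ t → length (nthL P (suc (suc t))) ≤ length (nthL P (suc t))
    rowLength-antitone t =
      subst₂ _≤_ (sym (rowLength (suc (suc t)))) (sym (rowLength (suc t))) (part-antitone (proj₁ pμ) t)

    length-P : length P ≡ length μ
    length-P = trans (sym (length-map length P)) (cong length shape)

  module Forward (P : Tab) (maxP : MaximalWithWeights P) where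

    shape : map length P ≡ μ
    shape = proj₁ (proj₁ (proj₁ maxP))

    entries≡row : ∀ i p x → x ∈ BoxAt P i p → x ≡ i
    entries≡row = proj₁ (proj₂ (proj₁ maxP))

    maximal : ∀ i → MaximalPair ℓ (nthL P (suc i)) (nthL P (suc (suc i)))
    maximal i = Equivalence.to (maximality⇔MaximalPair ℓ P i) (proj₂ (proj₂ (proj₁ maxP)) i)

    nonEmptyRows : All NonEmptyBoxes P
    nonEmptyRows = All.map ValidBoxes⇒NonEmptyBoxes (proj₁ (proj₂ (proj₁ (proj₁ maxP))))

    nonEmpty : ∀ i → NonEmptyBoxes (nthL P i)
    nonEmpty = All-nthL nonEmptyRows []

    open Shaped P shape public

    filled : RowsFilledFrom 1 P
    filled = BoxAt≡i⇒RowsFilledFrom1 P entries≡row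

    row-weight : ∀ t → part λ' (suc t) ≡ part μ (suc t) + length (labels ℓ (nthL P (suc t)))
    row-weight t = trans (sym (proj₁ (proj₂ maxP) (suc t)))
      (trans (wtMT≡boxes+labels ℓ P filled nonEmptyRows t) (cong (_+ _) (rowLength (suc t))))

    length-λ≡length-μ : length λ' ≡ length μ
    length-λ≡length-μ with length μ <? length λ'
    ... | no |μ|≮|λ| = ≤-antisym (≮⇒≥ |μ|≮|λ|) length-μ≤length-λ
    ... | yes |μ|<|λ| = ⊥-elim (<⇒≱ (s≤s z≤n) (subst (1 ≤_) last-part-empty (part-λ-pos |μ|<|λ|)))
      where
      last-part-empty : part λ' (length λ') ≡ 0
      last-part-empty = trans (sym (proj₁ (proj₂ maxP) (length λ')))
                              (wtMT-beyond P filled (length λ') (subst (_< length λ') (sym length-P) |μ|<|λ|))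

    rows-increase : ∀ i x a b → ent μ (toRT P) i x ≡ just a → ent μ (toRT P) i (suc x) ≡ just b → a ≤ b
    rows-increase i x a b rewrite nthL-toRT P i = Sorted⇒ent-monotone (labels-sorted ℓ (nthL P i)) (part μ i) x a b

    label-bounds : ∀ t → All (λ b → 1 ≤ b × b ≤ ℓ) (labels ℓ (nthL P (suc t)))
    label-bounds t = All.zip ( labels-pos ℓ (nthL P (suc t)) (rowLength≤ℓ (suc t))
                             , All.map proj₁ (labels-bounds ℓ (nthL P (suc t))))

    columns-increase : ∀ i x a b → ent μ (toRT P) i x ≡ just a → ent μ (toRT P) (suc i) x ≡ just b → a < b
    columns-increase zero x a b ea eb with () ← trans (sym (nth-[] (x ∸ part μ 0))) ea
    columns-increase (suc t) x a b rewrite nthL-toRT P (suc t) | nthL-toRT P (suc (suc t)) =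
      Covers⇒ColumnStrict (labels-sorted ℓ u) (labels-sorted ℓ v) (part-antitone (proj₁ pμ) t)
        (label-bounds (suc t)) covers x a b
      where
      u = nthL P (suc t)
      v = nthL P (suc (suc t))
      covers : ∀ k → k < ℓ → Covers (labels ℓ u) (labels ℓ v) (part μ (suc t)) (part μ (suc (suc t))) k
      covers k k<ℓ = subst₂ (λ m m' → Covers (labels ℓ u) (labels ℓ v) m m' k)
                       (rowLength (suc t)) (rowLength (suc (suc t)))
                       (MaximalPair⇒Covers ℓ u v (nonEmpty (suc t)) (nonEmpty (suc (suc t)))
                          (rowLength-antitone t) (rowLength≤ℓ (suc t)) (maximal t) k k<ℓ)

    -- A label a in row t+1 sits in a box of the column labelled a, which has at least t+1 boxes.
    entries-restricted : ∀ i x a → ent μ (toRT P) i x ≡ just a → 1 ≤ a × a ≤ ℓ × i ≤ colLen ℓ μ a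
    entries-restricted zero x a ea with () ← trans (sym (nth-[] (x ∸ part μ 0))) ea
    entries-restricted (suc t) x a ea rewrite nthL-toRT P (suc t) =
      let a∈ = nth≡just⇒∈ {u = labels ℓ u} {x ∸ part μ (suc t)} ea
          (a≤ℓ , ℓ<a+|u|) = All.lookup (labels-bounds ℓ u) a∈
      in All.lookup (labels-pos ℓ u (rowLength≤ℓ (suc t))) a∈ , a≤ℓ ,
         ≤part⇒<count≥ (proj₁ pμ) (suc ℓ ∸ a) t (m<n⇒0<n∸m (s≤s a≤ℓ))
           (subst (suc ℓ ∸ a ≤_) (trans (m+n∸m≡n a (length u)) (rowLength (suc t))) (∸-monoˡ-≤ a ℓ<a+|u|))
      where u = nthL P (suc t)

    weight-toRT : ∀ j → wtRT (toRT P) (suc (toℕ j)) ≡ lookup T j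
    weight-toRT j = +-cancelˡ-≡ (colLen ℓ μ n) _ _ (begin
      colLen ℓ μ n + wtRT (toRT P) n
        ≡⟨ cong (λ ν → colLen ℓ ν n + wtRT (toRT P) n) shape ⟨
      colLen ℓ (map length P) n + wtRT (toRT P) n
        ≡⟨ colEntries≡colLen+wtRT ℓ n P nonEmptyRows (s≤s z≤n) (toℕ<n j) ⟨
      colEntries ℓ P n
        ≡⟨ proj₂ (proj₂ maxP) j ⟩
      lookup T j + colLen ℓ μ n
        ≡⟨ +-comm (lookup T j) _ ⟩
      colLen ℓ μ n + lookup T j ∎)
      where
      open ≡-Reasoning
      n = suc (toℕ j)

    toRT-restricted : RestrictedWithWeight (toRT P)
    toRT-restricted =
      ( trans (length-map (labels ℓ) P) (trans length-P (sym length-λ≡length-μ))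
      , row-lengths , rows-increase , columns-increase , entries-restricted)
      , weight-toRT
      where
      row-lengths : ∀ i → length (nthL (toRT P) i) ≡ part λ' i ∸ part μ i
      row-lengths zero = refl
      row-lengths (suc t) rewrite nthL-toRT P (suc t) | row-weight t = sym (m+n∸m≡n (part μ (suc t)) _)

  module Backward (R : SkewTab) (rtR : RestrictedWithWeight R) where

    rowLength-R : ∀ i → length (nthL R i) ≡ part λ' i ∸ part μ i
    rowLength-R = proj₁ (proj₂ (proj₁ rtR))

    rows-R : ∀ i x a b → ent μ R i x ≡ just a → ent μ R i (suc x) ≡ just b → a ≤ b
    rows-R = proj₁ (proj₂ (proj₂ (proj₁ rtR)))

    columns-R : ∀ i x a b → ent μ R i x ≡ just a → ent μ R (suc i) x ≡ just b → a < b
    columns-R = proj₁ (proj₂ (proj₂ (proj₂ (proj₁ rtR))))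

    entries : ∀ i x a → ent μ R i x ≡ just a → 1 ≤ a × a ≤ ℓ × i ≤ colLen ℓ μ a
    entries = proj₂ (proj₂ (proj₂ (proj₂ (proj₁ rtR))))

    ent-R : ∀ i y {a} → nth (nthL R i) y ≡ just a → ent μ R i (part μ i + y) ≡ just a
    ent-R i y e = trans (cong (nth (nthL R i)) (m+n∸m≡n (part μ i) y)) e

    μ+R≡λ : ∀ i → part μ i + length (nthL R i) ≡ part λ' i
    μ+R≡λ i = trans (cong (part μ i +_) (rowLength-R i)) (m+[n∸m]≡n (μ⊆λ i))

    -- A cell in a row below μ would need a column of μ of that length.
    length-λ≡length-μ : length λ' ≡ length μ
    length-λ≡length-μ with length μ <? length λ'
    ... | no |μ|≮|λ| = ≤-antisym (≮⇒≥ |μ|≮|λ|) length-μ≤length-λ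
    ... | yes |μ|<|λ| = ⊥-elim (<⇒≱ |μ|<|λ| (≤-trans n≤colLen (length-filter _ μ)))
      where
      n = length λ'
      cell : Σ ℕ λ a → nth (nthL R n) 1 ≡ just a
      cell = nth-inRange (nthL R n) 1 (s≤s z≤n)
               (subst (1 ≤_) (sym (trans (rowLength-R n) (cong (part λ' n ∸_) (part-beyond μ n |μ|<|λ|))))
                      (part-λ-pos |μ|<|λ|))
      n≤colLen = proj₂ (proj₂ (entries n (part μ n + 1) (proj₁ cell) (ent-R n 1 (proj₂ cell))))

    sorted-R : ∀ i → Sorted (nthL R i)
    sorted-R i = nth-monotone⇒Sorted (nthL R i) λ y a b ea eb →
      rows-R i (part μ i + y) a b (ent-R i y ea)
        (trans (cong (λ x → nth (nthL R i) (x ∸ part μ i)) (sym (+-suc (part μ i) y))) (ent-R i (suc y) eb))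

    -- Entry a lies in row t+1 ≤ c_a, i.e. column ℓ+1-a of μ reaches row t+1.
    R-label-bounds : ∀ t → All (λ a → a ≤ ℓ × ℓ < a + part μ (suc t)) (nthL R (suc t))
    R-label-bounds t = All.tabulate λ {a} a∈ →
      let (y , ea) = ∈⇒nth≡just a∈
          (_ , a≤ℓ , t<colLen) = entries (suc t) _ a (ent-R (suc t) (suc y) ea)
          ℓ+1-a≤μ = <count≥⇒≤part (proj₁ pμ) (suc ℓ ∸ a) t t<colLen
      in a≤ℓ , subst (suc ℓ ≤_) (+-comm (part μ (suc t)) a)
                 (subst (_≤ part μ (suc t) + a) (m∸n+n≡m (m≤n⇒m≤1+n a≤ℓ)) (+-monoˡ-≤ a ℓ+1-a≤μ))

    P : Tab
    P = tableauOf ℓ 1 μ R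

    row-P : ∀ t → nthL P (suc t) ≡ rowOf ℓ (part μ (suc t)) (nthL R (suc t)) (suc t)
    row-P = nthL-tableauOf ℓ 1 μ R

    shape-P : map length P ≡ μ
    shape-P = shape-tableauOf ℓ 1 μ R

    open Shaped P shape-P

    toRT-P : toRT P ≡ R
    toRT-P = nthL-ext (toRT P) R
      (trans (length-map (labels ℓ) P) (trans length-P
        (sym (trans (proj₁ (proj₁ rtR)) length-λ≡length-μ))))
      λ t → trans (nthL-toRT P (suc t)) (trans (cong (labels ℓ) (row-P t))
              (labels-rowOf ℓ (part μ (suc t)) (sorted-R (suc t)) (R-label-bounds t) (part-μ≤ℓ (suc t)) (suc t)))

    labels-row-P : ∀ i → labels ℓ (nthL P i) ≡ nthL R i
    labels-row-P i = trans (sym (nthL-toRT P i)) (cong (λ Q → nthL Q i) toRT-P)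

    valid-P : All (All ValidBox) P
    valid-P = tableauOf-valid ℓ 1 μ R (s≤s z≤n)

    nonEmpty-P : All NonEmptyBoxes P
    nonEmpty-P = All.map ValidBoxes⇒NonEmptyBoxes valid-P

    entries-P : ∀ i p x → x ∈ BoxAt P i p → x ≡ i
    entries-P zero p x x∈ rewrite nthL-[] {ℕ} p with () ← x∈
    entries-P (suc t) p x x∈ rewrite row-P t =
      All.lookup (All-nthL (rowOf-filled ℓ (part μ (suc t)) (nthL R (suc t)) (suc t)) [] p) x∈

    maximal-P : ∀ i k →
      sumTo k (λ j → bsize ℓ P (suc (suc i)) j) ≤ 1 + sumTo k (λ j → bsize ℓ P (suc i) (j ∸ 1))
    maximal-P i = Equivalence.from (maximality⇔MaximalPair ℓ P i)
                      (Covers⇒MaximalPair ℓ u v (All-nthL nonEmpty-P [] (suc i)) (All-nthL nonEmpty-P [] (suc (suc i)))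
                        (rowLength-antitone i) (rowLength≤ℓ (suc i)) covers)
      where
      u = nthL P (suc i)
      v = nthL P (suc (suc i))
      covers : ∀ k → Covers (labels ℓ u) (labels ℓ v) (length u) (length v) k
      covers k = subst₂ (λ c c' → c ≤ c')
        (sym (cong₂ (λ m w → m + count≤ (suc k) w) (rowLength (suc (suc i))) (labels-row-P (suc (suc i)))))
        (sym (cong₂ (λ m w → m + count≤ k w) (rowLength (suc i)) (labels-row-P (suc i))))
        (ColumnStrict⇒Covers (sorted-R (suc i)) (sorted-R (suc (suc i))) (part-antitone (proj₁ pμ) i)
          (subst₂ _≤_ (sym (μ+R≡λ (suc (suc i)))) (sym (μ+R≡λ (suc i))) (part-antitone (proj₁ pλ) i))
          (columns-R (suc i)) k)

    filled-P : RowsFilledFrom 1 P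
    filled-P = BoxAt≡i⇒RowsFilledFrom1 P entries-P

    weight-P : ∀ n → wtMT P n ≡ part λ' n
    weight-P zero = wtMT-below 1 P filled-P 0 (s≤s z≤n)
    weight-P (suc t) = begin
      wtMT P (suc t)
        ≡⟨ wtMT≡boxes+labels ℓ P filled-P nonEmpty-P t ⟩
      length (nthL P (suc t)) + length (labels ℓ (nthL P (suc t)))
        ≡⟨ cong₂ _+_ (rowLength (suc t)) (cong length (labels-row-P (suc t))) ⟩
      part μ (suc t) + length (nthL R (suc t))
        ≡⟨ μ+R≡λ (suc t) ⟩
      part λ' (suc t) ∎
      where open ≡-Reasoning

    columnWeight-P : ∀ j → colEntries ℓ P (suc (toℕ j)) ≡ lookup T j + colLen ℓ μ (suc (toℕ j))
    columnWeight-P j = begin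
      colEntries ℓ P n
        ≡⟨ colEntries≡colLen+wtRT ℓ n P nonEmpty-P (s≤s z≤n) (toℕ<n j) ⟩
      colLen ℓ (map length P) n + wtRT (toRT P) n
        ≡⟨ cong₂ (λ ν Q → colLen ℓ ν n + wtRT Q n) shape-P toRT-P ⟩
      colLen ℓ μ n + wtRT R n
        ≡⟨ cong (colLen ℓ μ n +_) (proj₂ rtR j) ⟩
      colLen ℓ μ n + lookup T j
        ≡⟨ +-comm (colLen ℓ μ n) (lookup T j) ⟩
      lookup T j + colLen ℓ μ n ∎
      where
      open ≡-Reasoning
      n = suc (toℕ j)

    P-maximal : MaximalWithWeights P
    P-maximal = ((shape-P , valid-P , below , right) , entries-P , maximal-P) , weight-P , columnWeight-P
      where
      below : ∀ i p x y → x ∈ BoxAt P i p → y ∈ BoxAt P (suc i) p → x < y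
      below i p x y x∈ y∈ rewrite entries-P i p x x∈ | entries-P (suc i) p y y∈ = ≤-refl
      right : ∀ i p x y → x ∈ BoxAt P i p → y ∈ BoxAt P i (suc p) → x ≤ y
      right i p x y x∈ y∈ rewrite entries-P i p x x∈ | entries-P i (suc p) y y∈ = ≤-refl

  toRT-injective : ∀ P P' → MaximalWithWeights P → MaximalWithWeights P' → toRT P ≡ toRT P' → P ≡ P'
  toRT-injective P P' maxP maxP' e = nthL-ext P P' (trans (F.length-P P maxP) (sym (F.length-P P' maxP'))) same-row
    where
    module F = Forward
    -- A row of a maximal tableau is recovered from its labels and its length.
    recover : ∀ Q maxQ t →
              rowOf ℓ (length (nthL Q (suc t))) (labels ℓ (nthL Q (suc t))) (suc t) ≡ nthL Q (suc t)
    recover Q maxQ t = rowOf-labels ℓ (suc t) (nthL Q (suc t)) (F.nonEmpty Q maxQ (suc t))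
                         (BoxAt≡i⇒row-filled Q (F.entries≡row Q maxQ) t) (F.rowLength≤ℓ Q maxQ (suc t))
    same-row : ∀ t → nthL P (suc t) ≡ nthL P' (suc t)
    same-row t = begin
      nthL P (suc t)
        ≡⟨ recover P maxP t ⟨
      rowOf ℓ (length (nthL P (suc t))) (labels ℓ (nthL P (suc t))) (suc t)
        ≡⟨ cong₂ (λ m w → rowOf ℓ m w (suc t)) same-length same-labels ⟩
      rowOf ℓ (length (nthL P' (suc t))) (labels ℓ (nthL P' (suc t))) (suc t)
        ≡⟨ recover P' maxP' t ⟩
      nthL P' (suc t) ∎
      where
      open ≡-Reasoning
      same-length = trans (F.rowLength P maxP (suc t)) (sym (F.rowLength P' maxP' (suc t)))
      same-labels = trans (sym (nthL-toRT P (suc t))) (trans (cong (λ Q → nthL Q (suc t)) e) (nthL-toRT P' (suc t)))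

  bijection : Bijection MaximalWithWeights RestrictedWithWeight
  bijection = toRT , Forward.toRT-restricted , toRT-injective , λ R rtR →
    Backward.P R rtR , Backward.P-maximal R rtR , Backward.toRT-P R rtR
proposition3p8 : (ℓ : ℕ) (μ λ' : List ℕ) (T : Vec ℕ ℓ)
    → IsPartition μ → part μ 1 ≡ ℓ
    → IsPartition λ' → μ ⊆ₚ λ'
    → Bijection
        (λ P → IsMaxMT ℓ μ P
             × (∀ n → wtMT P n ≡ part λ' n)
             × (∀ j → colEntries ℓ P (suc (toℕ j)) ≡ lookup T j + colLen ℓ μ (suc (toℕ j))))
        (λ R → IsRT ℓ λ' μ R
             × (∀ j → wtRT R (suc (toℕ j)) ≡ lookup T j))
proposition3p8 ℓ μ λ' T pμ μ₁≡ℓ pλ μ⊆λ = Correspondence.bijection ℓ μ λ' T pμ μ₁≡ℓ pλ μ⊆λ
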